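{- Let $p$ be a prime and let $A=(a_1,\dots,a_\ell)$, $B=(b_1,\dots,b_\ell)$ be two sequences of $\ell>p$ elements of $\mathbb{F}_p$ such that all $a_i$ are nonzero. Then $\mathcal{S}_A\subseteq\mathcal{S}_B$ if and only if $A$ and $B$ are collinear as vectors of $\mathbb{F}_p^\ell$.
   Context: For a sequence $C=(c_1,\dots,c_\ell)$ of elements of $\mathbb{F}_p$, $\mathcal{S}_C=\{x\in\{0,1\}^\ell : c_1x_1+\dots+c_\ell x_\ell=0 \text{ in } \mathbb{F}_p\}$ denotes the set of $0$-$1$ solutions of the equation $c_1x_1+\dots+c_\ell x_\ell=0$. -}

module Defs where

open import Data.Nat using (ℕ; _+_; _*_)
open import Data.Nat.Divisibility using (_∣_)
open import Data.Integer as ℤ using (ℤ; +_)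
open import Data.Integer.Divisibility as ℤD using ()
open import Data.Fin using (Fin; toℕ)
open import Data.Bool using (Bool; true; false)
open import Data.Vec using (Vec; []; _∷_; lookup)
open import Data.Product using (∃; _×_)
open import Data.Sum using (_⊎_)

-- Elements of 𝔽_p are represented by their residues, i.e. by Fin p.
-- Vectors in 𝔽_p^ℓ are Vec (Fin p) ℓ; a 0-1 vector x ∈ {0,1}^ℓ is a Vec Bool ℓ.

bit : Bool → ℕ
bit true  = 1
bit false = 0

linSum : ∀ {p ℓ} → Vec (Fin p) ℓ → Vec Bool ℓ → ℕ
linSum []       []       = 0
linSum (c ∷ cs) (x ∷ xs) = toℕ c * bit x + linSum cs xs

_∈𝒮_ : ∀ {p ℓ} → Vec Bool ℓ → Vec (Fin p) ℓ → Set
_∈𝒮_ {p} x C = p ∣ linSum C x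

_⊆𝒮_ : ∀ {p ℓ} → Vec (Fin p) ℓ → Vec (Fin p) ℓ → Set
_⊆𝒮_ {ℓ = ℓ} A B = (x : Vec Bool ℓ) → x ∈𝒮 A → x ∈𝒮 B

_≡[mod_]_ : ℕ → ℕ → ℕ → Set
a ≡[mod p ] b = (+ p) ℤD.∣ ((+ a) ℤ.- (+ b))

IsMultipleBy : ∀ {p ℓ} → Fin p → Vec (Fin p) ℓ → Vec (Fin p) ℓ → Set
IsMultipleBy {p} λ′ C D = ∀ i → toℕ (lookup D i) ≡[mod p ] (toℕ λ′ * toℕ (lookup C i))

Collinear : ∀ {p ℓ} → Vec (Fin p) ℓ → Vec (Fin p) ℓ → Set
Collinear {p} A B = (∃ λ (μ : Fin p) → IsMultipleBy μ A B) ⊎ (∃ λ (μ : Fin p) → IsMultipleBy μ B A)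

module Submission where

-- Proof (polynomial method via finite differences), on integer representatives a, b.
-- For f : ℤ² → ℤ and a set S of coordinates, D_S f applies the differences Δ_{(aᵢ , bᵢ)},
-- i ∈ S, to f.  It is an alternating sum of values f (a·x , b·x), x ∈ {0,1}^ℓ, and it
-- kills every f of degree < |S|.  Take f (u , v) = (u - 1)(u - 2)⋯(u - (p - 1)) · v.
-- If 𝒮_A ⊆ 𝒮_B then p divides every f (a·x , b·x), hence, for |S| = p, p divides
-- D_S f = (p - 1)! · σ_S  where  σ_S = ∑_{i ∈ S} bᵢ ∏_{j ∈ S ∖ i} aⱼ;  so p ∣ σ_S.
-- As ℓ ≥ p + 1, for each t ≠ 0 some S₀ of size p - 1 avoids 0 and t, and comparing σ on
-- S₀ ∪ {0} and S₀ ∪ {t} gives a₀ bₜ ≡ aₜ b₀; thus B ≡ (a₀⁻¹ b₀) A.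

open import Defs
open import Data.Nat using (ℕ; _<_)
open import Data.Nat.Primality using (Prime)
open import Data.Fin using (Fin; toℕ)
open import Data.Vec using (Vec; lookup)
open import Data.Nat.Divisibility using (_∣_)
open import Relation.Nullary using (¬_)
open import Function.Bundles using (_⇔_)

open import Data.Nat.Base as ℕ using (zero; suc; _!; NonZero; z≤n; s≤s)
import Data.Nat.Properties as ℕP
import Data.Nat.Divisibility as ℕD
open import Data.Nat.Primality using (euclidsLemma; prime⇒nonTrivial)
open import Data.Nat.Coprimality using (coprime-Bézout; prime⇒coprime)
open import Data.Nat.GCD using (module Bézout)
open import Data.Integer.Base using (ℤ; +_; 0ℤ; 1ℤ; -1ℤ; _+_; _-_; _*_; -_; _^_; ∣_∣)
open import Data.Integer.Properties
  using (pos-*; pos-+; +-identityˡ; +-identityʳ; +-inverseʳ; *-zeroʳ; *-comm; abs-*; i-j≡0⇒i≡j)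
open import Data.Integer.Tactic.RingSolver using (solve-∀)
open import Data.Integer.Divisibility.Signed
  using (divides; ∣ᵤ⇒∣; ∣⇒∣ᵤ; ∣-refl; ∣-trans; ∣m∣n⇒∣m+n; ∣m∣n⇒∣m-n; ∣m⇒∣m*n; ∣n⇒∣m*n; _∣?_)
  renaming (_∣_ to _∣ℤ_)
open import Data.Integer.DivMod using (_%ℕ_; _/ℕ_; n%ℕd<d; a≡a%ℕn+[a/ℕn]*n)
open import Data.Fin.Base using (fromℕ<)
import Data.Fin.Base as F
open import Data.Fin.Properties using (toℕ-fromℕ<; toℕ<n)
open import Data.Bool.Base using (Bool; true; false)
open import Data.Vec.Base using ([]; _∷_; map)
open import Data.Vec.Properties using (lookup-map)
open import Data.Product using (Σ; _×_; _,_)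
open import Data.Sum using (_⊎_; inj₁; inj₂)
import Data.Sum as Sum
open import Data.Empty using (⊥-elim)
open import Relation.Nullary using (yes; no)
open import Function.Bundles using (Equivalence; mk⇔)
import Function.Properties.Equivalence as ⇔
open import Relation.Binary.PropositionalEquality

Fn : Set
Fn = ℤ → ℤ → ℤ

infix 4 _≗₂_
_≗₂_ : Fn → Fn → Set
f ≗₂ g = ∀ u v → f u v ≡ g u v

infixl 6 _⊕_ _⊝_
infixl 7 _⊛_

_⊕_ _⊝_ : Fn → Fn → Fn
(f ⊕ g) u v = f u v + g u v
(f ⊝ g) u v = f u v - g u v

_⊛_ : ℤ → Fn → Fn
(k ⊛ f) u v = k * f u v

U V : Fn → Fn
U f u v = u * f u v
V f u v = v * f u v

shift : ℤ → ℤ → Fn → Fn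
shift a b f u v = f (u + a) (v + b)

Δ : ℤ → ℤ → Fn → Fn
Δ a b f = shift a b f ⊝ f

Deg< : ℕ → Fn → Set
Deg< zero    f = ∀ u v → f u v ≡ 0ℤ
Deg< (suc d) f = ∀ a b → Deg< d (Δ a b f)

Δ-resp : ∀ a b {f g} → f ≗₂ g → Δ a b f ≗₂ Δ a b g
Δ-resp a b f≗g u v = cong₂ _-_ (f≗g (u + a) (v + b)) (f≗g u v)

deg-resp : ∀ d {f g} → f ≗₂ g → Deg< d f → Deg< d g
deg-resp zero    f≗g df u v = trans (sym (f≗g u v)) (df u v)
deg-resp (suc d) f≗g df a b = deg-resp d (Δ-resp a b f≗g) (df a b)

deg-⊕ : ∀ d f g → Deg< d f → Deg< d g → Deg< d (f ⊕ g)
deg-⊕ zero    f g df dg u v rewrite df u v | dg u v = refl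
deg-⊕ (suc d) f g df dg a b =
  deg-resp d (λ u v → Δ-additive (f (u + a) (v + b)) (g (u + a) (v + b)) (f u v) (g u v))
    (deg-⊕ d (Δ a b f) (Δ a b g) (df a b) (dg a b))
  where
  Δ-additive : ∀ (x y z w : ℤ) → (x - z) + (y - w) ≡ (x + y) - (z + w)
  Δ-additive = solve-∀

deg-⊛ : ∀ d k f → Deg< d f → Deg< d (k ⊛ f)
deg-⊛ zero    k f df u v rewrite df u v = *-zeroʳ k
deg-⊛ (suc d) k f df a b =
  deg-resp d (λ u v → Δ-homogeneous k (f (u + a) (v + b)) (f u v))
    (deg-⊛ d k (Δ a b f) (df a b))
  where
  Δ-homogeneous : ∀ (k x z : ℤ) → k * (x - z) ≡ k * x - k * z
  Δ-homogeneous = solve-∀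

deg-⊝ : ∀ d f g → Deg< d f → Deg< d g → Deg< d (f ⊝ g)
deg-⊝ d f g df dg =
  deg-resp d (λ u v → minus (f u v) (g u v)) (deg-⊕ d f (-1ℤ ⊛ g) df (deg-⊛ d -1ℤ g dg))
  where
  minus : ∀ (x y : ℤ) → x + -1ℤ * y ≡ x - y
  minus = solve-∀

deg-shift : ∀ d a b f → Deg< d f → Deg< d (shift a b f)
deg-shift zero    a b f df u v = df (u + a) (v + b)
deg-shift (suc d) a b f df a′ b′ =
  deg-resp d (λ u v → cong₂ (λ s t → f s t - f (u + a) (v + b)) (swap u a′ a) (swap v b′ b))
    (deg-shift d a b (Δ a′ b′ f) (df a′ b′))
  where
  swap : ∀ (x y z : ℤ) → x + z + y ≡ x + y + z
  swap = solve-∀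

deg-suc : ∀ d f → Deg< d f → Deg< (suc d) f
deg-suc zero    f df a b u v rewrite df (u + a) (v + b) | df u v = refl
deg-suc (suc d) f df a b = deg-suc d (Δ a b f) (df a b)

deg-const : ∀ k → Deg< 1 (λ _ _ → k)
deg-const k a b u v = +-inverseʳ k

-- Multiplying by a coordinate raises the degree by at most one, by the
-- product rule  Δ (u·f) = u · Δ f + a · (shift f).
deg-U : ∀ d f → Deg< d f → Deg< (suc d) (U f)
deg-U zero f df a b u v rewrite df (u + a) (v + b) | df u v = vanish (u + a) u
  where
  vanish : ∀ (s t : ℤ) → s * 0ℤ - t * 0ℤ ≡ 0ℤ
  vanish = solve-∀
deg-U (suc d) f df a b =
  deg-resp (suc d) (λ u v → product-rule u a (f (u + a) (v + b)) (f u v))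
    (deg-⊕ (suc d) (U (Δ a b f)) (a ⊛ shift a b f)
      (deg-U d (Δ a b f) (df a b)) (deg-⊛ (suc d) a (shift a b f) (deg-shift (suc d) a b f df)))
  where
  product-rule : ∀ (u a x y : ℤ) → u * (x - y) + a * x ≡ (u + a) * x - u * y
  product-rule = solve-∀

deg-V : ∀ d f → Deg< d f → Deg< (suc d) (V f)
deg-V zero f df a b u v rewrite df (u + a) (v + b) | df u v = vanish (v + b) v
  where
  vanish : ∀ (s t : ℤ) → s * 0ℤ - t * 0ℤ ≡ 0ℤ
  vanish = solve-∀
deg-V (suc d) f df a b =
  deg-resp (suc d) (λ u v → product-rule v b (f (u + a) (v + b)) (f u v))
    (deg-⊕ (suc d) (V (Δ a b f)) (b ⊛ shift a b f)
      (deg-V d (Δ a b f) (df a b)) (deg-⊛ (suc d) b (shift a b f) (deg-shift (suc d) a b f df)))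
  where
  product-rule : ∀ (v b x y : ℤ) → v * (x - y) + b * x ≡ (v + b) * x - v * y
  product-rule = solve-∀

mono : ℕ → Fn
mono m u v = u ^ m

monoV : ℕ → Fn
monoV m u v = u ^ m * v

deg-mono : ∀ m → Deg< (suc m) (mono m)
deg-mono zero    = deg-const 1ℤ
deg-mono (suc m) = deg-U (suc m) (mono m) (deg-mono m)

Δ-mono : ∀ m a b → Deg< m (Δ a b (mono (suc m)) ⊝ (+ suc m * a) ⊛ mono m)
Δ-mono zero    a b u v = leading u a
  where
  leading : ∀ (u a : ℤ) → ((u + a) * 1ℤ - u * 1ℤ) - 1ℤ * a * 1ℤ ≡ 0ℤ
  leading = solve-∀
-- Inductively, Δ u^{m+2} - (m+2)·a·u^{m+1} = u · (Δ u^{m+1} - (m+1)·a·u^m) + a · Δ u^{m+1}.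
Δ-mono (suc m) a b =
  deg-resp (suc m) (λ u v → split u a ((u + a) ^ m) (u ^ m) (+ suc m))
    (deg-⊕ (suc m) (U (Δ a b (mono (suc m)) ⊝ (+ suc m * a) ⊛ mono m)) (a ⊛ Δ a b (mono (suc m)))
      (deg-U m _ (Δ-mono m a b))
      (deg-⊛ (suc m) a _ (deg-mono (suc m) a b)))
  where
  split : ∀ (u a X Y M : ℤ) →
    u * (((u + a) * X - u * Y) - M * a * Y) + a * ((u + a) * X - u * Y)
    ≡ ((u + a) * ((u + a) * X) - u * (u * Y)) - (1ℤ + M) * a * (u * Y)
  split = solve-∀

-- Here Δ (u^{m+1} v) - (top terms) = v · (Δ u^{m+1} - (m+1)·a·u^m) + b · Δ u^{m+1}.
Δ-monoV : ∀ m a b →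
  Deg< (suc m) (Δ a b (monoV (suc m)) ⊝ ((+ suc m * a) ⊛ monoV m ⊕ b ⊛ mono (suc m)))
Δ-monoV m a b =
  deg-resp (suc m) (λ u v → split v b ((u + a) ^ suc m) (u ^ suc m) (u ^ m) (+ suc m) a)
    (deg-⊕ (suc m) (V (Δ a b (mono (suc m)) ⊝ (+ suc m * a) ⊛ mono m)) (b ⊛ Δ a b (mono (suc m)))
      (deg-V m _ (Δ-mono m a b))
      (deg-⊛ (suc m) b _ (deg-mono (suc m) a b)))
  where
  split : ∀ (v b X Y Z M a : ℤ) →
    v * ((X - Y) - M * a * Z) + b * (X - Y)
    ≡ (X * (v + b) - Y * v) - (M * a * (Z * v) + b * Y)
  split = solve-∀

φ : ℕ → ℤ → ℤ
φ zero    u = 1ℤ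
φ (suc k) u = φ k u * (u - + suc k)

-- φ k is monic of degree k, so  φ k (u) · v  agrees with u^k v up to degree < k+1;
-- inductively  φ (k+1) - u^{k+1} = u · (φ k - u^k) - (k+1) · φ k.
deg-φ-mono : ∀ k → Deg< k ((λ u v → φ k u) ⊝ mono k)
deg-φ-mono zero    u v = refl
deg-φ-mono (suc k) =
  deg-resp (suc k) (λ u v → expand u (φ k u) (u ^ k) (+ suc k))
    (deg-⊝ (suc k) (U (φk ⊝ mono k)) (+ suc k ⊛ φk)
      (deg-U k _ (deg-φ-mono k))
      (deg-⊛ (suc k) (+ suc k) φk
        (deg-resp (suc k) (λ u v → cancel (φ k u) (u ^ k))
          (deg-⊕ (suc k) (φk ⊝ mono k) (mono k) (deg-suc k _ (deg-φ-mono k)) (deg-mono k)))))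
  where
  φk : Fn
  φk u v = φ k u
  expand : ∀ (u P Y N : ℤ) → u * (P - Y) - N * P ≡ P * (u - N) - u * Y
  expand = solve-∀
  cancel : ∀ (P Y : ℤ) → (P - Y) + Y ≡ P
  cancel = solve-∀

deg-φV-monoV : ∀ k → Deg< (suc k) ((λ u v → φ k u * v) ⊝ monoV k)
deg-φV-monoV k = deg-resp (suc k) (λ u v → factor v (φ k u) (u ^ k)) (deg-V k _ (deg-φ-mono k))
  where
  factor : ∀ (v P Y : ℤ) → v * (P - Y) ≡ P * v - Y * v
  factor = solve-∀

size : ∀ {n} → Vec Bool n → ℕ
size []          = 0
size (true ∷ S)  = suc (size S)
size (false ∷ S) = size S

D : ∀ {n} → Vec ℤ n → Vec ℤ n → Vec Bool n → Fn → Fn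
D []       []       []          f = f
D (a ∷ as) (b ∷ bs) (false ∷ S) f = D as bs S f
D (a ∷ as) (b ∷ bs) (true ∷ S)  f = D as bs S (Δ a b f)

-- π a S = ∏_{i ∈ S} aᵢ   and   σ a b S = ∑_{i ∈ S} bᵢ ∏_{j ∈ S, j ≠ i} aⱼ.
π : ∀ {n} → Vec ℤ n → Vec Bool n → ℤ
π []       []          = 1ℤ
π (a ∷ as) (false ∷ S) = π as S
π (a ∷ as) (true ∷ S)  = a * π as S

σ : ∀ {n} → Vec ℤ n → Vec ℤ n → Vec Bool n → ℤ
σ []       []       []          = 0ℤ
σ (a ∷ as) (b ∷ bs) (false ∷ S) = σ as bs S
σ (a ∷ as) (b ∷ bs) (true ∷ S)  = b * π as S + a * σ as bs S

σ-empty : ∀ {n} (as bs : Vec ℤ n) S → size S ≡ 0 → σ as bs S ≡ 0ℤ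
σ-empty []       []       []          _  = refl
σ-empty (a ∷ as) (b ∷ bs) (false ∷ S) e  = σ-empty as bs S e
σ-empty (a ∷ as) (b ∷ bs) (true ∷ S)  ()

D-resp : ∀ {n} (as bs : Vec ℤ n) S {f g} → f ≗₂ g → D as bs S f ≗₂ D as bs S g
D-resp []       []       []          f≗g = f≗g
D-resp (a ∷ as) (b ∷ bs) (false ∷ S) f≗g = D-resp as bs S f≗g
D-resp (a ∷ as) (b ∷ bs) (true ∷ S)  f≗g = D-resp as bs S (Δ-resp a b f≗g)

D-⊕ : ∀ {n} (as bs : Vec ℤ n) S f g → D as bs S (f ⊕ g) ≗₂ D as bs S f ⊕ D as bs S g
D-⊕ []       []       []          f g u v = refl
D-⊕ (a ∷ as) (b ∷ bs) (false ∷ S) f g     = D-⊕ as bs S f g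
D-⊕ (a ∷ as) (b ∷ bs) (true ∷ S)  f g u v =
  trans (D-resp as bs S {g = Δ a b f ⊕ Δ a b g}
          (λ u v → regroup (f (u + a) (v + b)) (g (u + a) (v + b)) (f u v) (g u v)) u v)
        (D-⊕ as bs S (Δ a b f) (Δ a b g) u v)
  where
  regroup : ∀ (x y z w : ℤ) → (x + y) - (z + w) ≡ (x - z) + (y - w)
  regroup = solve-∀

D-⊛ : ∀ {n} (as bs : Vec ℤ n) S k f → D as bs S (k ⊛ f) ≗₂ k ⊛ D as bs S f
D-⊛ []       []       []          k f u v = refl
D-⊛ (a ∷ as) (b ∷ bs) (false ∷ S) k f     = D-⊛ as bs S k f
D-⊛ (a ∷ as) (b ∷ bs) (true ∷ S)  k f u v =
  trans (D-resp as bs S {g = k ⊛ Δ a b f}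
          (λ u v → distrib k (f (u + a) (v + b)) (f u v)) u v)
        (D-⊛ as bs S k (Δ a b f) u v)
  where
  distrib : ∀ (k x z : ℤ) → k * x - k * z ≡ k * (x - z)
  distrib = solve-∀

D-vanish : ∀ {n} (as bs : Vec ℤ n) S f → Deg< (size S) f → ∀ u v → D as bs S f u v ≡ 0ℤ
D-vanish []       []       []          f df = df
D-vanish (a ∷ as) (b ∷ bs) (false ∷ S) f df = D-vanish as bs S f df
D-vanish (a ∷ as) (b ∷ bs) (true ∷ S)  f df = D-vanish as bs S (Δ a b f) (df a b)

D-congr : ∀ {n} (as bs : Vec ℤ n) S f g → Deg< (size S) (f ⊝ g) → D as bs S f ≗₂ D as bs S g
D-congr as bs S f g df-g u v = i-j≡0⇒i≡j _ _ (begin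
    D as bs S f u v - D as bs S g u v
  ≡⟨ cong (λ t → D as bs S f u v + t) (sym (minus-one (D as bs S g u v))) ⟩
    D as bs S f u v + -1ℤ * D as bs S g u v
  ≡⟨ cong (λ t → D as bs S f u v + t) (sym (D-⊛ as bs S -1ℤ g u v)) ⟩
    D as bs S f u v + D as bs S (-1ℤ ⊛ g) u v
  ≡⟨ sym (D-⊕ as bs S f (-1ℤ ⊛ g) u v) ⟩
    D as bs S (f ⊕ -1ℤ ⊛ g) u v
  ≡⟨ D-resp as bs S {g = f ⊝ g} (λ u v → cong (λ t → f u v + t) (minus-one (g u v))) u v ⟩
    D as bs S (f ⊝ g) u v
  ≡⟨ D-vanish as bs S (f ⊝ g) df-g u v ⟩
    0ℤ ∎)
  where
  open ≡-Reasoning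
  minus-one : ∀ (x : ℤ) → -1ℤ * x ≡ - x
  minus-one = solve-∀

D-mono : ∀ {n} (as bs : Vec ℤ n) S → D as bs S (mono (size S)) ≗₂ λ _ _ → + (size S !) * π as S
D-mono []       []       []          u v = refl
D-mono (a ∷ as) (b ∷ bs) (false ∷ S)     = D-mono as bs S
D-mono (a ∷ as) (b ∷ bs) (true ∷ S)  u v = begin
    D as bs S (Δ a b (mono (suc m))) u v
  ≡⟨ D-congr as bs S _ _ (Δ-mono m a b) u v ⟩
    D as bs S ((+ suc m * a) ⊛ mono m) u v
  ≡⟨ D-⊛ as bs S (+ suc m * a) (mono m) u v ⟩
    (+ suc m * a) * D as bs S (mono m) u v
  ≡⟨ cong ((+ suc m * a) *_) (D-mono as bs S u v) ⟩
    (+ suc m * a) * (+ (m !) * π as S)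
  ≡⟨ regroup (+ suc m) a (+ (m !)) (π as S) ⟩
    (+ suc m * + (m !)) * (a * π as S)
  ≡⟨ cong (_* (a * π as S)) (sym (pos-* (suc m) (m !))) ⟩
    + (suc m !) * (a * π as S) ∎
  where
  m = size S
  open ≡-Reasoning
  regroup : ∀ (M a F P : ℤ) → (M * a) * (F * P) ≡ (M * F) * (a * P)
  regroup = solve-∀

D-monoV : ∀ {n} (as bs : Vec ℤ n) S m → size S ≡ suc m →
  D as bs S (monoV m) ≗₂ λ _ _ → + (m !) * σ as bs S
D-monoV []       []       []          m ()
D-monoV (a ∷ as) (b ∷ bs) (false ∷ S) m |S|≡1+m = D-monoV as bs S m |S|≡1+m
D-monoV (a ∷ as) (b ∷ bs) (true ∷ S)  zero |S|≡1 u v = begin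
    D as bs S (Δ a b (monoV 0)) u v
  ≡⟨ D-resp as bs S {g = b ⊛ mono 0} (λ u v → Δ-linear v b) u v ⟩
    D as bs S (b ⊛ mono 0) u v
  ≡⟨ D-⊛ as bs S b (mono 0) u v ⟩
    b * D as bs S (mono 0) u v
  ≡⟨ cong (λ k → b * D as bs S (mono k) u v) (sym |S|≡0) ⟩
    b * D as bs S (mono (size S)) u v
  ≡⟨ cong (b *_) (D-mono as bs S u v) ⟩
    b * (+ (size S !) * π as S)
  ≡⟨ cong (λ k → b * (+ (k !) * π as S)) |S|≡0 ⟩
    b * (1ℤ * π as S)
  ≡⟨ unit b (π as S) a ⟩
    1ℤ * (b * π as S + a * 0ℤ)
  ≡⟨ cong (λ s → 1ℤ * (b * π as S + a * s)) (σ-empty as bs S |S|≡0) ⟨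
    1ℤ * (b * π as S + a * σ as bs S) ∎
  where
  |S|≡0 = ℕP.suc-injective |S|≡1
  open ≡-Reasoning
  Δ-linear : ∀ (v b : ℤ) → 1ℤ * (v + b) - 1ℤ * v ≡ b * 1ℤ
  Δ-linear = solve-∀
  unit : ∀ (b P a : ℤ) → b * (1ℤ * P) ≡ 1ℤ * (b * P + a * 0ℤ)
  unit = solve-∀
D-monoV (a ∷ as) (b ∷ bs) (true ∷ S) (suc m) |S|≡2+m u v = begin
    D as bs S (Δ a b (monoV (suc m))) u v
  ≡⟨ D-congr as bs S _ _ (subst (λ k → Deg< k _) (sym |S|≡1+m) (Δ-monoV m a b)) u v ⟩
    D as bs S ((+ suc m * a) ⊛ monoV m ⊕ b ⊛ mono (suc m)) u v
  ≡⟨ D-⊕ as bs S ((+ suc m * a) ⊛ monoV m) (b ⊛ mono (suc m)) u v ⟩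
    D as bs S ((+ suc m * a) ⊛ monoV m) u v + D as bs S (b ⊛ mono (suc m)) u v
  ≡⟨ cong₂ _+_ (D-⊛ as bs S (+ suc m * a) (monoV m) u v) (D-⊛ as bs S b (mono (suc m)) u v) ⟩
    (+ suc m * a) * D as bs S (monoV m) u v + b * D as bs S (mono (suc m)) u v
  ≡⟨ cong₂ (λ x y → (+ suc m * a) * x + b * y) (D-monoV as bs S m |S|≡1+m u v) top ⟩
    (+ suc m * a) * (+ (m !) * σ as bs S) + b * (+ (suc m !) * π as S)
  ≡⟨ cong (λ k → (+ suc m * a) * (+ (m !) * σ as bs S) + b * (k * π as S)) (pos-* (suc m) (m !)) ⟩
    (+ suc m * a) * (+ (m !) * σ as bs S) + b * ((+ suc m * + (m !)) * π as S)
  ≡⟨ regroup (+ suc m) a (+ (m !)) (σ as bs S) b (π as S) ⟩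
    (+ suc m * + (m !)) * (b * π as S + a * σ as bs S)
  ≡⟨ cong (_* (b * π as S + a * σ as bs S)) (pos-* (suc m) (m !)) ⟨
    + (suc m !) * (b * π as S + a * σ as bs S) ∎
  where
  |S|≡1+m = ℕP.suc-injective |S|≡2+m
  open ≡-Reasoning
  top : D as bs S (mono (suc m)) u v ≡ + (suc m !) * π as S
  top = subst (λ k → D as bs S (mono k) u v ≡ + (k !) * π as S) |S|≡1+m (D-mono as bs S u v)
  regroup : ∀ (M a F s b P : ℤ) → (M * a) * (F * s) + b * ((M * F) * P) ≡ (M * F) * (b * P + a * s)
  regroup = solve-∀

insert : ∀ {n} → Vec Bool n → Fin n → Vec Bool n
insert (s ∷ S) F.zero    = true ∷ S
insert (s ∷ S) (F.suc t) = s ∷ insert S t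

size-insert : ∀ {n} (S : Vec Bool n) t → lookup S t ≡ false → size (insert S t) ≡ suc (size S)
size-insert (false ∷ S) F.zero    _   = refl
size-insert (true ∷ S)  (F.suc t) t∉S = cong suc (size-insert S t t∉S)
size-insert (false ∷ S) (F.suc t) t∉S = size-insert S t t∉S

π-insert : ∀ {n} (as : Vec ℤ n) S t → lookup S t ≡ false →
  π as (insert S t) ≡ lookup as t * π as S
π-insert (a ∷ as) (false ∷ S) F.zero    _   = refl
π-insert (a ∷ as) (false ∷ S) (F.suc t) t∉S = π-insert as S t t∉S
π-insert (a ∷ as) (true ∷ S)  (F.suc t) t∉S =
  trans (cong (a *_) (π-insert as S t t∉S)) (swap a (lookup as t) (π as S))
  where
  swap : ∀ (x y z : ℤ) → x * (y * z) ≡ y * (x * z)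
  swap = solve-∀

σ-insert : ∀ {n} (as bs : Vec ℤ n) S t → lookup S t ≡ false →
  σ as bs (insert S t) ≡ lookup bs t * π as S + lookup as t * σ as bs S
σ-insert (a ∷ as) (b ∷ bs) (false ∷ S) F.zero    _   = refl
σ-insert (a ∷ as) (b ∷ bs) (false ∷ S) (F.suc t) t∉S = σ-insert as bs S t t∉S
σ-insert (a ∷ as) (b ∷ bs) (true ∷ S)  (F.suc t) t∉S =
  trans (cong₂ (λ x y → b * x + a * y) (π-insert as S t t∉S) (σ-insert as bs S t t∉S))
        (regroup a b (lookup as t) (lookup bs t) (π as S) (σ as bs S))
  where
  regroup : ∀ (a b aₜ bₜ P s : ℤ) → b * (aₜ * P) + a * (bₜ * P + aₜ * s) ≡ bₜ * (a * P) + aₜ * (b * P + a * s)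
  regroup = solve-∀

mask-of-size : ∀ {n} k → k ℕ.≤ n → Σ (Vec Bool n) λ S → size S ≡ k
mask-of-size {zero}  zero    z≤n       = [] , refl
mask-of-size {suc n} zero    z≤n       with mask-of-size {n} zero z≤n
... | S , |S|≡0 = false ∷ S , |S|≡0
mask-of-size {suc n} (suc k) (s≤s k≤n) with mask-of-size k k≤n
... | S , |S|≡k = true ∷ S , cong suc |S|≡k

mask-avoiding : ∀ {n} k (t : Fin n) → k ℕ.< n → Σ (Vec Bool n) λ S → size S ≡ k × lookup S t ≡ false
mask-avoiding k F.zero (s≤s k≤n) with mask-of-size k k≤n
... | S , |S|≡k = false ∷ S , |S|≡k , refl
mask-avoiding {suc (suc n)} zero (F.suc t) _ with mask-avoiding zero t (s≤s z≤n)
... | S , |S|≡0 , t∉S = false ∷ S , |S|≡0 , t∉S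
mask-avoiding (suc k) (F.suc t) (s≤s k<n) with mask-avoiding k t k<n
... | S , |S|≡k , t∉S = true ∷ S , cong suc |S|≡k , t∉S

ssum : ∀ {n} → Vec ℤ n → Vec Bool n → ℤ
ssum []       []          = 0ℤ
ssum (a ∷ as) (true ∷ x)  = a + ssum as x
ssum (a ∷ as) (false ∷ x) = ssum as x

-- D a b S f (u , v) is an alternating sum of values f (u + a·x , v + b·x), x ∈ {0,1}^n;
-- so it is divisible by m whenever all these values are.
D-divisible : ∀ (m : ℤ) {n} (as bs : Vec ℤ n) S f u v →
  (∀ x → m ∣ℤ f (u + ssum as x) (v + ssum bs x)) → m ∣ℤ D as bs S f u v
D-divisible m []       []       []          f u v h =
  subst₂ (λ s t → m ∣ℤ f s t) (+-identityʳ u) (+-identityʳ v) (h [])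
D-divisible m (a ∷ as) (b ∷ bs) (false ∷ S) f u v h =
  D-divisible m as bs S f u v (λ x → h (false ∷ x))
D-divisible m (a ∷ as) (b ∷ bs) (true ∷ S)  f u v h =
  D-divisible m as bs S (Δ a b f) u v λ x →
    ∣m∣n⇒∣m-n (subst₂ (λ s t → m ∣ℤ f s t) (reorder u a (ssum as x)) (reorder v b (ssum bs x))
                 (h (true ∷ x)))
              (h (false ∷ x))
  where
  reorder : ∀ (u a s : ℤ) → u + (a + s) ≡ u + s + a
  reorder = solve-∀

residue : ∀ m .{{_ : NonZero m}} z → Σ (Fin m) λ μ → + m ∣ℤ z - + toℕ μ
residue m z = fromℕ< (n%ℕd<d z m) , divides (z /ℕ m) (begin
    z - + toℕ (fromℕ< (n%ℕd<d z m))
  ≡⟨ cong (λ r → z - + r) (toℕ-fromℕ< (n%ℕd<d z m)) ⟩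
    z - + (z %ℕ m)
  ≡⟨ cong (λ y → y - + (z %ℕ m)) (a≡a%ℕn+[a/ℕn]*n z m) ⟩
    (+ (z %ℕ m) + (z /ℕ m) * + m) - + (z %ℕ m)
  ≡⟨ cancel (+ (z %ℕ m)) ((z /ℕ m) * + m) ⟩
    (z /ℕ m) * + m ∎)
  where
  open ≡-Reasoning
  cancel : ∀ (r y : ℤ) → (r + y) - r ≡ y
  cancel = solve-∀

φ-factor : ∀ k t u → 1 ℕ.≤ t → t ℕ.≤ k → (u - + t) ∣ℤ φ k u
φ-factor zero    t u 1≤t t≤0   = ⊥-elim (ℕP.<⇒≱ 1≤t t≤0)
φ-factor (suc k) t u 1≤t t≤1+k with ℕP.m≤n⇒m<n∨m≡n t≤1+k
... | inj₁ t<1+k = ∣m⇒∣m*n (u - + suc k) (φ-factor k t u 1≤t (ℕP.≤-pred t<1+k))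
... | inj₂ refl  = ∣n⇒∣m*n (φ k u) ∣-refl

φ-vanishes : ∀ k z → ¬ + suc k ∣ℤ z → + suc k ∣ℤ φ k z
φ-vanishes k z p∤z with residue (suc k) z
... | F.zero  , p∣z-0 = ⊥-elim (p∤z (subst (+ suc k ∣ℤ_) (+-identityʳ z) p∣z-0))
... | F.suc μ , p∣z-μ = ∣-trans p∣z-μ (φ-factor k (suc (toℕ μ)) z (s≤s z≤n) (toℕ<n μ))

lift : ∀ a b c d e → a ℕ.+ b ℕ.* c ≡ d ℕ.* e → + a + + b * + c ≡ + d * + e
lift a b c d e eq = begin
    + a + + b * + c    ≡⟨ cong (λ t → + a + t) (pos-* b c) ⟨
    + a + + (b ℕ.* c)  ≡⟨ pos-+ a (b ℕ.* c) ⟨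
    + (a ℕ.+ b ℕ.* c)  ≡⟨ cong +_ eq ⟩
    + (d ℕ.* e)        ≡⟨ pos-* d e ⟩
    + d * + e          ∎
  where open ≡-Reasoning

Multiple : ∀ {n} → ℤ → ℤ → Vec ℤ n → Vec ℤ n → Set
Multiple m μ cs ds = ∀ t → m ∣ℤ lookup ds t - μ * lookup cs t

ssum-multiple : ∀ {n} m μ (cs ds : Vec ℤ n) → Multiple m μ cs ds → ∀ x → m ∣ℤ ssum ds x - μ * ssum cs x
ssum-multiple m μ []       []       _     [] = subst (m ∣ℤ_) (sym (annihilate μ)) (∣n⇒∣m*n 0ℤ ∣-refl)
  where
  annihilate : ∀ (μ : ℤ) → 0ℤ - μ * 0ℤ ≡ 0ℤ * m
  annihilate = solve-∀
ssum-multiple m μ (c ∷ cs) (d ∷ ds) d≡μc (false ∷ x) = ssum-multiple m μ cs ds (λ t → d≡μc (F.suc t)) x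
ssum-multiple m μ (c ∷ cs) (d ∷ ds) d≡μc (true ∷ x)  =
  subst (m ∣ℤ_) (regroup d c μ (ssum ds x) (ssum cs x))
    (∣m∣n⇒∣m+n (d≡μc F.zero) (ssum-multiple m μ cs ds (λ t → d≡μc (F.suc t)) x))
  where
  regroup : ∀ (d c μ D C : ℤ) → (d - μ * c) + (D - μ * C) ≡ (d + D) - μ * (c + C)
  regroup = solve-∀

module ModPrime (k : ℕ) (p-prime : Prime (suc k)) where
  p : ℕ
  p = suc k

  euclid : ∀ x y → + p ∣ℤ x * y → + p ∣ℤ x ⊎ + p ∣ℤ y
  euclid x y p∣xy with euclidsLemma ∣ x ∣ ∣ y ∣ p-prime (subst (p ∣_) (abs-* x y) (∣⇒∣ᵤ p∣xy))
  ... | inj₁ p∣x = inj₁ (∣ᵤ⇒∣ p∣x)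
  ... | inj₂ p∣y = inj₂ (∣ᵤ⇒∣ p∣y)

  cancel : ∀ x y → ¬ + p ∣ℤ y → + p ∣ℤ x * y → + p ∣ℤ x
  cancel x y p∤y p∣xy with euclid x y p∣xy
  ... | inj₁ p∣x = p∣x
  ... | inj₂ p∣y = ⊥-elim (p∤y p∣y)

  p∤1 : ¬ p ∣ 1
  p∤1 p∣1 = ℕP.<-irrefl (sym (ℕD.∣1⇒≡1 p∣1)) (ℕ.nonTrivial⇒n>1 p {{prime⇒nonTrivial p-prime}})

  p∤! : ∀ m → m ℕ.< p → ¬ p ∣ m !
  p∤! zero    _   = p∤1
  p∤! (suc m) m<p p∣m! with euclidsLemma (suc m) (m !) p-prime p∣m!
  ... | inj₁ p∣1+m = ℕP.<⇒≱ m<p (ℕD.∣⇒≤ p∣1+m)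
  ... | inj₂ p∣m!  = p∤! m (ℕP.<-trans (ℕP.n<1+n m) m<p) p∣m!

  -- Integers which are nonzero mod p are invertible mod p: first for residues 0 < r < p,
  -- by Bézout's identity for the coprime pair (p , r), then for all z via z ≡ r.
  inverse-of-residue : ∀ {r} .{{_ : NonZero r}} → r ℕ.< p → Σ ℤ λ w → + p ∣ℤ w * + r - 1ℤ
  inverse-of-residue {r} r<p with coprime-Bézout (prime⇒coprime p-prime r<p)
  ... | Bézout.+- x y 1+yr≡xp =
    - + y , divides (- + x)
      (trans (negate (+ y) (+ r)) (trans (cong -_ (lift 1 y r x p 1+yr≡xp)) (neg-mul (+ x) (+ p))))
    where
    negate : ∀ (y r : ℤ) → - y * r - 1ℤ ≡ - (1ℤ + y * r)
    negate = solve-∀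
    neg-mul : ∀ (x p : ℤ) → - (x * p) ≡ - x * p
    neg-mul = solve-∀
  ... | Bézout.-+ x y 1+xp≡yr =
    + y , divides (+ x) (trans (cong (_- 1ℤ) (sym (lift 1 x p y r 1+xp≡yr))) (drop-one (+ x * + p)))
    where
    drop-one : ∀ (z : ℤ) → (1ℤ + z) - 1ℤ ≡ z
    drop-one = solve-∀

  inverse : ∀ z → ¬ + p ∣ℤ z → Σ ℤ λ w → + p ∣ℤ w * z - 1ℤ
  inverse z p∤z with residue p z
  ... | F.zero  , p∣z-0 = ⊥-elim (p∤z (subst (+ p ∣ℤ_) (+-identityʳ z) p∣z-0))
  ... | F.suc μ , p∣z-r with inverse-of-residue (toℕ<n (F.suc μ))
  ...   | w , p∣wr-1 =
    w , subst (+ p ∣ℤ_) (regroup w (+ suc (toℕ μ)) z) (∣m∣n⇒∣m+n p∣wr-1 (∣n⇒∣m*n w p∣z-r))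
    where
    regroup : ∀ (w r z : ℤ) → (w * r - 1ℤ) + w * (z - r) ≡ w * z - 1ℤ
    regroup = solve-∀

  _⊆ₚ_ : ∀ {n} → Vec ℤ n → Vec ℤ n → Set
  as ⊆ₚ bs = ∀ x → + p ∣ℤ ssum as x → + p ∣ℤ ssum bs x

  π-nonzero : ∀ {n} (as : Vec ℤ n) → (∀ i → ¬ + p ∣ℤ lookup as i) → ∀ S → ¬ + p ∣ℤ π as S
  π-nonzero []       _     []          p∣1 = p∤1 (∣⇒∣ᵤ p∣1)
  π-nonzero (a ∷ as) as≢0 (false ∷ S) p∣π = π-nonzero as (λ i → as≢0 (F.suc i)) S p∣π
  π-nonzero (a ∷ as) as≢0 (true ∷ S)  p∣aπ with euclid a (π as S) p∣aπ
  ... | inj₁ p∣a = as≢0 F.zero p∣a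
  ... | inj₂ p∣π = π-nonzero as (λ i → as≢0 (F.suc i)) S p∣π

  -- If 𝒮_a ⊆ 𝒮_b then σ a b S ≡ 0 (mod p) for every S of size p.
  -- The function f (u , v) = φ (p-1) u · v vanishes mod p at every (a·x , b·x), so its
  -- top difference D a b S f = (p-1)! σ a b S is divisible by p, and p ∤ (p-1)!.
  σ-divisible : ∀ {n} (as bs : Vec ℤ n) → as ⊆ₚ bs → ∀ S → size S ≡ p → + p ∣ℤ σ as bs S
  σ-divisible as bs 𝒮a⊆𝒮b S |S|≡p =
    cancel (σ as bs S) (+ (k !)) (λ p∣k! → p∤! k ℕP.≤-refl (∣⇒∣ᵤ p∣k!))
    (subst (+ p ∣ℤ_) top-difference (D-divisible (+ p) as bs S f 0ℤ 0ℤ f-vanishes))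
    where
    f : Fn
    f u v = φ k u * v
    f-vanishes-at : ∀ x → + p ∣ℤ f (ssum as x) (ssum bs x)
    f-vanishes-at x with + p ∣? ssum as x
    ... | yes p∣ax = ∣n⇒∣m*n (φ k (ssum as x)) (𝒮a⊆𝒮b x p∣ax)
    ... | no  p∤ax = ∣m⇒∣m*n (ssum bs x) (φ-vanishes k (ssum as x) p∤ax)
    f-vanishes : ∀ x → + p ∣ℤ f (0ℤ + ssum as x) (0ℤ + ssum bs x)
    f-vanishes x =
      subst₂ (λ s t → + p ∣ℤ f s t) (sym (+-identityˡ _)) (sym (+-identityˡ _)) (f-vanishes-at x)
    top-difference : D as bs S f 0ℤ 0ℤ ≡ σ as bs S * + (k !)
    top-difference = begin
        D as bs S f 0ℤ 0ℤ
      ≡⟨ D-congr as bs S f (monoV k) (subst (λ d → Deg< d _) (sym |S|≡p) (deg-φV-monoV k)) 0ℤ 0ℤ ⟩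
        D as bs S (monoV k) 0ℤ 0ℤ
      ≡⟨ D-monoV as bs S k |S|≡p 0ℤ 0ℤ ⟩
        + (k !) * σ as bs S
      ≡⟨ *-comm (+ (k !)) (σ as bs S) ⟩
        σ as bs S * + (k !) ∎
      where open ≡-Reasoning

  -- Comparing the sets S₀ ∪ {0} and S₀ ∪ {t} for some S₀ of size p - 1 avoiding 0 and t
  -- (possible as n > p) shows  a₀ bₜ ≡ aₜ b₀ (mod p)  for every coordinate t.
  cross-products : ∀ {n} a b (as bs : Vec ℤ n) → p ℕ.≤ n → (∀ i → ¬ + p ∣ℤ lookup as i) →
    (a ∷ as) ⊆ₚ (b ∷ bs) → ∀ t → + p ∣ℤ a * lookup (b ∷ bs) t - lookup (a ∷ as) t * b
  cross-products a b as bs p≤n as≢0 𝒮⊆𝒮 F.zero =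
    subst (+ p ∣ℤ_) (sym (+-inverseʳ (a * b))) (∣n⇒∣m*n 0ℤ ∣-refl)
  cross-products a b as bs p≤n as≢0 𝒮⊆𝒮 (F.suc t) with mask-avoiding k t p≤n
  ... | S , |S|≡k , t∉S = cancel (a * bₜ - aₜ * b) (π as S) (π-nonzero as as≢0 S)
    (subst (+ p ∣ℤ_) eliminate-σ (∣m∣n⇒∣m-n (∣n⇒∣m*n a p∣σₜ) (∣n⇒∣m*n aₜ p∣σ₀)))
    where
    aₜ = lookup as t
    bₜ = lookup bs t
    p∣σ₀ : + p ∣ℤ b * π as S + a * σ as bs S
    p∣σ₀ = σ-divisible (a ∷ as) (b ∷ bs) 𝒮⊆𝒮 (true ∷ S) (cong suc |S|≡k)
    p∣σₜ : + p ∣ℤ bₜ * π as S + aₜ * σ as bs S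
    p∣σₜ = subst (+ p ∣ℤ_) (σ-insert as bs S t t∉S)
      (σ-divisible (a ∷ as) (b ∷ bs) 𝒮⊆𝒮 (false ∷ insert S t) (trans (size-insert S t t∉S) (cong suc |S|≡k)))
    eliminate-σ : a * (bₜ * π as S + aₜ * σ as bs S) - aₜ * (b * π as S + a * σ as bs S)
                ≡ (a * bₜ - aₜ * b) * π as S
    eliminate-σ = eliminate a b aₜ bₜ (π as S) (σ as bs S)
      where
      eliminate : ∀ (a b aₜ bₜ P s : ℤ) → a * (bₜ * P + aₜ * s) - aₜ * (b * P + a * s) ≡ (a * bₜ - aₜ * b) * P
      eliminate = solve-∀

  Collinearₚ : ∀ {n} → Vec ℤ n → Vec ℤ n → Set
  Collinearₚ cs ds = (Σ (Fin p) λ μ → Multiple (+ p) (+ toℕ μ) cs ds)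
                   ⊎ (Σ (Fin p) λ μ → Multiple (+ p) (+ toℕ μ) ds cs)

  -- If a ≢ 0 and a·dₜ ≡ cₜ·b for all t, then d ≡ μ·c with μ ≡ a⁻¹ b.
  proportional⇒multiple : ∀ {n} a b (cs ds : Vec ℤ n) → ¬ + p ∣ℤ a →
    (∀ t → + p ∣ℤ a * lookup ds t - lookup cs t * b) → Σ (Fin p) λ μ → Multiple (+ p) (+ toℕ μ) cs ds
  proportional⇒multiple a b cs ds p∤a proportional with inverse a p∤a
  ... | w , p∣wa-1 with residue p (w * b)
  ...   | μ , p∣wb-μ = μ , λ t →
    subst (+ p ∣ℤ_) (combine (lookup ds t) (lookup cs t) w a b (+ toℕ μ))
      (∣m∣n⇒∣m+n (∣m∣n⇒∣m+n (∣n⇒∣m*n (- lookup ds t) p∣wa-1) (∣n⇒∣m*n w (proportional t)))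
                 (∣n⇒∣m*n (lookup cs t) p∣wb-μ))
    where
    combine : ∀ (d c w a b μ : ℤ) →
      (- d) * (w * a - 1ℤ) + w * (a * d - c * b) + c * (w * b - μ) ≡ d - μ * c
    combine = solve-∀

  -- Conversely d ≡ μ·c gives 𝒮_c ⊆ 𝒮_d; so does c ≡ μ·d when c₀ ≢ 0, since then μ ≢ 0.
  multiple⇒⊆ : ∀ {n} μ (cs ds : Vec ℤ n) → Multiple (+ p) μ cs ds → cs ⊆ₚ ds
  multiple⇒⊆ μ cs ds d≡μc x p∣cx =
    subst (+ p ∣ℤ_) (cancel-μ (ssum ds x) (μ * ssum cs x))
      (∣m∣n⇒∣m+n (ssum-multiple (+ p) μ cs ds d≡μc x) (∣n⇒∣m*n μ p∣cx))
    where
    cancel-μ : ∀ (d c : ℤ) → (d - c) + c ≡ d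
    cancel-μ = solve-∀

  multiple⇒⊇ : ∀ {n} μ (cs ds : Vec ℤ (suc n)) → ¬ + p ∣ℤ lookup cs F.zero →
    Multiple (+ p) μ ds cs → cs ⊆ₚ ds
  multiple⇒⊇ μ cs ds p∤c₀ c≡μd x p∣cx
    with euclid μ (ssum ds x) (subst (+ p ∣ℤ_) (cancel-c (ssum cs x) (μ * ssum ds x))
                                (∣m∣n⇒∣m-n p∣cx (ssum-multiple (+ p) μ ds cs c≡μd x)))
    where
    cancel-c : ∀ (c y : ℤ) → c - (c - y) ≡ y
    cancel-c = solve-∀
  ... | inj₂ p∣dx = p∣dx
  ... | inj₁ p∣μ  = ⊥-elim (p∤c₀ (subst (+ p ∣ℤ_) (cancel-μd (lookup cs F.zero) (μ * lookup ds F.zero))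
                      (∣m∣n⇒∣m+n (c≡μd F.zero) (∣m⇒∣m*n (lookup ds F.zero) p∣μ))))
    where
    cancel-μd : ∀ (c y : ℤ) → (c - y) + y ≡ c
    cancel-μd = solve-∀

  ⊆⇔collinear : ∀ {n} (cs ds : Vec ℤ (suc n)) → p ℕ.< suc n → (∀ i → ¬ + p ∣ℤ lookup cs i) →
    cs ⊆ₚ ds ⇔ Collinearₚ cs ds
  ⊆⇔collinear (c ∷ cs) (d ∷ ds) (s≤s p≤n) c≢0 = mk⇔
    (λ 𝒮⊆𝒮 → inj₁ (proportional⇒multiple c d (c ∷ cs) (d ∷ ds) (c≢0 F.zero)
                     (cross-products c d cs ds p≤n (λ i → c≢0 (F.suc i)) 𝒮⊆𝒮)))
    λ { (inj₁ (μ , d≡μc)) → multiple⇒⊆ (+ toℕ μ) (c ∷ cs) (d ∷ ds) d≡μc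
      ; (inj₂ (μ , c≡μd)) → multiple⇒⊇ (+ toℕ μ) (c ∷ cs) (d ∷ ds) (c≢0 F.zero) c≡μd }

toℤ : ∀ {p} → Fin p → ℤ
toℤ c = + toℕ c

linSum-ssum : ∀ {p n} (C : Vec (Fin p) n) x → + linSum C x ≡ ssum (map toℤ C) x
linSum-ssum []      []          = refl
linSum-ssum (c ∷ C) (true ∷ x)  =
  trans (pos-+ (toℕ c ℕ.* 1) (linSum C x)) (cong₂ _+_ (cong +_ (ℕP.*-identityʳ (toℕ c))) (linSum-ssum C x))
linSum-ssum (c ∷ C) (false ∷ x) =
  trans (cong (λ t → + (t ℕ.+ linSum C x)) (ℕP.*-zeroʳ (toℕ c))) (linSum-ssum C x)

module Translate (k : ℕ) (p-prime : Prime (suc k)) where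
  open ModPrime k p-prime

  ⊆𝒮⇔⊆ₚ : ∀ {n} (A B : Vec (Fin p) n) → A ⊆𝒮 B ⇔ map toℤ A ⊆ₚ map toℤ B
  ⊆𝒮⇔⊆ₚ A B = mk⇔
    (λ A⊆B x p∣Ax → subst (+ p ∣ℤ_) (linSum-ssum B x)
                      (∣ᵤ⇒∣ (A⊆B x (∣⇒∣ᵤ (subst (+ p ∣ℤ_) (sym (linSum-ssum A x)) p∣Ax)))))
    (λ A⊆B x p∣Ax → ∣⇒∣ᵤ (subst (+ p ∣ℤ_) (sym (linSum-ssum B x))
                      (A⊆B x (subst (+ p ∣ℤ_) (linSum-ssum A x) (∣ᵤ⇒∣ p∣Ax)))))

  nonzero : ∀ {n} (A : Vec (Fin p) n) i → ¬ (toℕ (lookup A i) ≡[mod p ] 0) → ¬ + p ∣ℤ lookup (map toℤ A) i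
  nonzero A i Aᵢ≢0 p∣Aᵢ =
    Aᵢ≢0 (∣⇒∣ᵤ (subst (+ p ∣ℤ_) (sym (+-identityʳ _)) (subst (+ p ∣ℤ_) (lookup-map i toℤ A) p∣Aᵢ)))

  multiple⇔ : ∀ {n} (μ : Fin p) (C D : Vec (Fin p) n) →
    IsMultipleBy μ C D ⇔ Multiple (+ p) (toℤ μ) (map toℤ C) (map toℤ D)
  multiple⇔ μ C D = mk⇔
    (λ D≡μC i → subst (+ p ∣ℤ_) (sym (entry i)) (∣ᵤ⇒∣ (D≡μC i)))
    (λ D≡μC i → ∣⇒∣ᵤ (subst (+ p ∣ℤ_) (entry i) (D≡μC i)))
    where
    entry : ∀ i → lookup (map toℤ D) i - toℤ μ * lookup (map toℤ C) i
                ≡ toℤ (lookup D i) - + (toℕ μ ℕ.* toℕ (lookup C i))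
    entry i = cong₂ (λ d c → d - c) (lookup-map i toℤ D)
                (trans (cong (toℤ μ *_) (lookup-map i toℤ C)) (sym (pos-* (toℕ μ) (toℕ (lookup C i)))))

  collinear⇔ : ∀ {n} (A B : Vec (Fin p) n) → Collinear A B ⇔ Collinearₚ (map toℤ A) (map toℤ B)
  collinear⇔ A B = mk⇔
    (Sum.map (λ (μ , B≡μA) → μ , to μ A B B≡μA) (λ (μ , A≡μB) → μ , to μ B A A≡μB))
    (Sum.map (λ (μ , B≡μA) → μ , from μ A B B≡μA) (λ (μ , A≡μB) → μ , from μ B A A≡μB))
    where
    to : ∀ μ C D → IsMultipleBy μ C D → Multiple (+ p) (toℤ μ) (map toℤ C) (map toℤ D)
    to μ C D = Equivalence.to (multiple⇔ μ C D)
    from : ∀ μ C D → Multiple (+ p) (toℤ μ) (map toℤ C) (map toℤ D) → IsMultipleBy μ C D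
    from μ C D = Equivalence.from (multiple⇔ μ C D)

corollary1p2 : (p ℓ : ℕ) → Prime p → p < ℓ → (A B : Vec (Fin p) ℓ)
    → (∀ i → ¬ (toℕ (lookup A i) ≡[mod p ] 0))
    → (A ⊆𝒮 B) ⇔ Collinear A B
corollary1p2 zero    _       p-prime =
  ⊥-elim (ℕP.<⇒≱ (ℕ.nonTrivial⇒n>1 0 {{prime⇒nonTrivial p-prime}}) ℕ.z≤n)
corollary1p2 (suc k) zero    p-prime ()
corollary1p2 (suc k) (suc n) p-prime p<ℓ A B A≢0 =
  ⇔.trans (⊆𝒮⇔⊆ₚ A B)
    (⇔.trans (⊆⇔collinear (map toℤ A) (map toℤ B) p<ℓ (λ i → nonzero A i (A≢0 i)))
             (⇔.sym (collinear⇔ A B)))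
  where
  open Translate k p-prime
  open ModPrime k p-prime
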